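{- Let $\Gamma$ be any finite set of parameters. For all $e, f \in \mathbb{E}$: \[ e \equiv f \implies [\![ e ]\!]_{\Gamma} = [\![ f ]\!]_{\Gamma}. \]
   Context: Fix countably infinite disjoint alphabets $\Sigma$ (atomic actions) and $\Pi$ (atomic propositions). The set $\mathbb{E}$ of expressions is given by $e,f ::= \mathtt{a}\in\Sigma \mid \mathtt{p}\in\Pi \mid \mathtt{0} \mid \mathtt{1} \mid e+f \mid e\cdot f \mid e^{\bot} \mid e^{\top} \mid e^{*}$ ($^{\bot}$ antidomain, $^{\top}$ domain). $\equiv$ is the smallest congruence on $\mathbb{E}$ satisfying the Kleene algebra axioms (idempotent semiring laws, $\mathtt{1}+e\cdot e^{*}\leqq e^{*}$, $\mathtt{1}+e^{*}\cdot e\leqq e^{*}$, $f+e\cdot g\leqq g \Rightarrow e^{*}\cdot f\leqq g$, $f+g\cdot e\leqq g\Rightarrow f\cdot e^{*}\leqq g$) together with $e^{\bot}\cdot e\equiv\mathtt{0}$, $(e\cdot f)^{\bot}\equiv(e\cdot f^{\top})^{\bot}$, $e^{\bot}+e^{\top}\equiv\mathtt{1}$, $\mathtt{p}^{\top}\equiv\mathtt{p}$, $e^{\top}\equiv e^{\bot\bot}$; $e\leqq f$ means $e+f\equiv f$. A test is $e^{\top}$ with $e$ containing no occurrence of $^{\top}$; a parameter is a test or an element of $\Pi$. For a finite set of parameters $\Gamma$ ordered as $\phi_1,\dots,\phi_n$, an atom is $\psi_1\cdots\psi_n$ with $\psi_i\in\{\phi_i,\phi_i^{\bot}\}$ (identified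 with the product expression); it is consistent iff $G\not\equiv\mathtt{0}$; $\mathbb{C}(\Gamma)$ is the set of consistent atoms; $\mathbb{CS}(\Gamma)$ is the set of strings $G_1\mathtt{a}_1G_2\cdots\mathtt{a}_{n-1}G_n$ with $G_i\in\mathbb{C}(\Gamma)$, $\mathtt{a}_j\in\Sigma$. Fusion product: $xG\diamond Hy=xGy$ if $G=H$, undefined otherwise, lifted to sets by $L\diamond K=\{w\diamond u\mid w\in L, u\in K\}$. $\mathbf{CL}(\Gamma)$ is the algebra of subsets of $\mathbb{CS}(\Gamma)$ with $\cup$, $\diamond$, $K^{*}=\bigcup_n K^n$ ($K^0=\mathbb{C}(\Gamma)$), $L^{\bot}=\{G\in\mathbb{C}(\Gamma)\mid\{G\}\diamond L=\emptyset\}$, $L^{\top}=\{G\in\mathbb{C}(\Gamma)\mid\{G\}\diamond L\neq\emptyset\}$, zero $\emptyset$, one $\mathbb{C}(\Gamma)$. The canonical $\Gamma$-interpretation $[\![ - ]\!]_{\Gamma}:\mathbb{E}\to\mathbf{CL}(\Gamma)$ is the unique homomorphism with $[\![ \mathtt{a} ]\!]_{\Gamma}=\{G\mathtt{a}H\in\mathbb{CS}(\Gamma)\mid G\mathtt{a}H\not\equiv\mathtt{0}\}$ and $[\![ \mathtt{p} ]\!]_{\Gamma}=\{G\in\mathbb{C}(\Gamma)\mid G\leqq\mathtt{p}\}$. -}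

module Defs where

open import Data.Nat using (ℕ)
open import Data.Bool using (Bool; true; false)
open import Data.List using (List; []; _∷_; length)
open import Data.List.Relation.Unary.All using (All)
open import Data.Vec using (Vec; []; _∷_)
open import Data.Product using (Σ; ∃; _×_; _,_)
open import Data.Sum using (_⊎_)
open import Data.Empty using (⊥)
open import Relation.Nullary using (¬_)
open import Relation.Binary.PropositionalEquality using (_≡_)
open import Function.Bundles using (_⇔_)

-- Expressions.  Σ (atomic actions) and Π (atomic propositions) are two
-- countably infinite disjoint alphabets, both represented by ℕ with
-- distinct constructors.

Act : Set
Act = ℕ

Prop : Set
Prop = ℕ

infixl 6 _⊕_
infixl 7 _⊙_

data Expr : Set where
  act  : Act → Expr
  prop : Prop → Expr
  𝟘    : Expr
  𝟙    : Expr
  _⊕_  : Expr → Expr → Expr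
  _⊙_  : Expr → Expr → Expr
  _ᴬ   : Expr → Expr
  _ᴰ   : Expr → Expr
  _⋆   : Expr → Expr

-- The congruence ≡ (written _≅_), and e ≦ f  :⇔  e + f ≡ f.

infix 4 _≅_ _≦_

data _≅_ : Expr → Expr → Set

_≦_ : Expr → Expr → Set
e ≦ f = e ⊕ f ≅ f

data _≅_ where
  ≅-refl  : ∀ {e} → e ≅ e
  ≅-sym   : ∀ {e f} → e ≅ f → f ≅ e
  ≅-trans : ∀ {e f g} → e ≅ f → f ≅ g → e ≅ g
  ⊕-cong  : ∀ {e e′ f f′} → e ≅ e′ → f ≅ f′ → e ⊕ f ≅ e′ ⊕ f′
  ⊙-cong  : ∀ {e e′ f f′} → e ≅ e′ → f ≅ f′ → e ⊙ f ≅ e′ ⊙ f′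
  ᴬ-cong  : ∀ {e e′} → e ≅ e′ → e ᴬ ≅ e′ ᴬ
  ᴰ-cong  : ∀ {e e′} → e ≅ e′ → e ᴰ ≅ e′ ᴰ
  ⋆-cong  : ∀ {e e′} → e ≅ e′ → e ⋆ ≅ e′ ⋆
  ⊕-assoc : ∀ e f g → (e ⊕ f) ⊕ g ≅ e ⊕ (f ⊕ g)
  ⊕-comm  : ∀ e f → e ⊕ f ≅ f ⊕ e
  ⊕-idem  : ∀ e → e ⊕ e ≅ e
  ⊕-zero  : ∀ e → e ⊕ 𝟘 ≅ e
  ⊙-assoc : ∀ e f g → (e ⊙ f) ⊙ g ≅ e ⊙ (f ⊙ g)
  ⊙-idˡ   : ∀ e → 𝟙 ⊙ e ≅ e
  ⊙-idʳ   : ∀ e → e ⊙ 𝟙 ≅ e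
  ⊙-zeroˡ : ∀ e → 𝟘 ⊙ e ≅ 𝟘
  ⊙-zeroʳ : ∀ e → e ⊙ 𝟘 ≅ 𝟘
  distribˡ : ∀ e f g → e ⊙ (f ⊕ g) ≅ (e ⊙ f) ⊕ (e ⊙ g)
  distribʳ : ∀ e f g → (f ⊕ g) ⊙ e ≅ (f ⊙ e) ⊕ (g ⊙ e)
  ⋆-unfoldˡ : ∀ e → 𝟙 ⊕ e ⊙ (e ⋆) ≦ e ⋆
  ⋆-unfoldʳ : ∀ e → 𝟙 ⊕ (e ⋆) ⊙ e ≦ e ⋆
  ⋆-indˡ    : ∀ {e f g} → f ⊕ e ⊙ g ≦ g → (e ⋆) ⊙ f ≦ g
  ⋆-indʳ    : ∀ {e f g} → f ⊕ g ⊙ e ≦ g → f ⊙ (e ⋆) ≦ g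
  ᴬ-annih  : ∀ e → (e ᴬ) ⊙ e ≅ 𝟘
  ᴬ-local  : ∀ e f → (e ⊙ f) ᴬ ≅ (e ⊙ (f ᴰ)) ᴬ
  ᴬᴰ-compl : ∀ e → (e ᴬ) ⊕ (e ᴰ) ≅ 𝟙
  prop-ᴰ   : ∀ p → (prop p) ᴰ ≅ prop p
  ᴰ-def    : ∀ e → e ᴰ ≅ (e ᴬ) ᴬ

data NoDom : Expr → Set where
  nd-act  : ∀ a → NoDom (act a)
  nd-prop : ∀ p → NoDom (prop p)
  nd-𝟘    : NoDom 𝟘
  nd-𝟙    : NoDom 𝟙
  nd-⊕    : ∀ {e f} → NoDom e → NoDom f → NoDom (e ⊕ f)
  nd-⊙    : ∀ {e f} → NoDom e → NoDom f → NoDom (e ⊙ f)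
  nd-ᴬ    : ∀ {e} → NoDom e → NoDom (e ᴬ)
  nd-⋆    : ∀ {e} → NoDom e → NoDom (e ⋆)

data IsTest : Expr → Set where
  test : ∀ {e} → NoDom e → IsTest (e ᴰ)

data IsParam : Expr → Set where
  param-test : ∀ {e} → IsTest e → IsParam e
  param-prop : ∀ p → IsParam (prop p)

-- Atoms over an ordered finite set of parameters Γ = φ₁,…,φₙ (a list).
-- An atom chooses ψᵢ ∈ {φᵢ, φᵢ^⊥}: true ↦ φᵢ, false ↦ φᵢ^⊥.

Atom : List Expr → Set
Atom Γ = Vec Bool (length Γ)

atomE : (Γ : List Expr) → Atom Γ → Expr
atomE []      []        = 𝟙
atomE (φ ∷ Γ) (true ∷ G)  = φ ⊙ atomE Γ G
atomE (φ ∷ Γ) (false ∷ G) = (φ ᴬ) ⊙ atomE Γ G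

Consistent : (Γ : List Expr) → Atom Γ → Set
Consistent Γ G = ¬ (atomE Γ G ≅ 𝟘)

data GS (Γ : List Expr) : Set where
  end  : Atom Γ → GS Γ
  step : Atom Γ → Act → GS Γ → GS Γ

module _ {Γ : List Expr} where

  first : GS Γ → Atom Γ
  first (end G)      = G
  first (step G _ _) = G

  gsE : GS Γ → Expr
  gsE (end G)      = atomE Γ G
  gsE (step G a w) = atomE Γ G ⊙ (act a ⊙ gsE w)

  data InCS : GS Γ → Set where
    cs-end  : ∀ {G} → Consistent Γ G → InCS (end G)
    cs-step : ∀ {G a w} → Consistent Γ G → InCS w → InCS (step G a w)

  data Fuse : GS Γ → GS Γ → GS Γ → Set where
    fuse-end  : ∀ {G y} → first y ≡ G → Fuse (end G) y y
    fuse-step : ∀ {G a x y z} → Fuse x y z → Fuse (step G a x) y (step G a z)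

-- The algebra 𝐂𝐋(Γ): subsets of ℂ𝕊(Γ), represented as predicates.

Lang : List Expr → Set₁
Lang Γ = GS Γ → Set

module _ {Γ : List Expr} where

  ∅L : Lang Γ
  ∅L _ = ⊥

  -- ℂ(Γ) viewed as a set of one-atom strings
  OneL : Lang Γ
  OneL w = Σ (Atom Γ) λ G → (w ≡ end G) × Consistent Γ G

  _∪L_ : Lang Γ → Lang Γ → Lang Γ
  (L ∪L K) w = L w ⊎ K w

  _◇_ : Lang Γ → Lang Γ → Lang Γ
  (L ◇ K) w = Σ (GS Γ) λ x → Σ (GS Γ) λ y → L x × K y × Fuse x y w

  powL : Lang Γ → ℕ → Lang Γ
  powL K ℕ.zero    = OneL
  powL K (ℕ.suc n) = powL K n ◇ K

  starL : Lang Γ → Lang Γ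
  starL K w = Σ ℕ λ n → powL K n w

  singleton : Atom Γ → Lang Γ
  singleton G w = w ≡ end G

  Empty : Lang Γ → Set
  Empty L = ∀ w → ¬ L w

  antidomL : Lang Γ → Lang Γ
  antidomL L w = Σ (Atom Γ) λ G → (w ≡ end G) × Consistent Γ G × Empty (singleton G ◇ L)

  domL : Lang Γ → Lang Γ
  domL L w = Σ (Atom Γ) λ G → (w ≡ end G) × Consistent Γ G × ¬ Empty (singleton G ◇ L)

  _≐_ : Lang Γ → Lang Γ → Set
  L ≐ K = ∀ w → L w ⇔ K w

⟦_⟧_ : Expr → (Γ : List Expr) → Lang Γ
⟦ act a ⟧ Γ  = λ w → Σ (Atom Γ) λ G → Σ (Atom Γ) λ H →
                 (w ≡ step G a (end H)) × InCS w × ¬ (gsE w ≅ 𝟘)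
⟦ prop p ⟧ Γ = λ w → Σ (Atom Γ) λ G →
                 (w ≡ end G) × Consistent Γ G × (atomE Γ G ≦ prop p)
⟦ 𝟘 ⟧ Γ      = ∅L
⟦ 𝟙 ⟧ Γ      = OneL
⟦ e ⊕ f ⟧ Γ  = (⟦ e ⟧ Γ) ∪L (⟦ f ⟧ Γ)
⟦ e ⊙ f ⟧ Γ  = (⟦ e ⟧ Γ) ◇ (⟦ f ⟧ Γ)
⟦ e ᴬ ⟧ Γ    = antidomL (⟦ e ⟧ Γ)
⟦ e ᴰ ⟧ Γ    = domL (⟦ e ⟧ Γ)
⟦ e ⋆ ⟧ Γ    = starL (⟦ e ⟧ Γ)

-- The semiring and Kleene-star laws
-- are those of fusion languages, where the atoms ℂ(Γ) act as unit only on
-- languages of consistent guarded strings.  For (anti)domain the point is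
-- that L^⊥ and L^⊤ depend only on the set of first atoms of L, which
-- gives locality; excluded middle is needed for e^⊥ + e^⊤ = 1 and for
-- p^⊤ = p, the latter holding for every language of single atoms.
module Submission where

open import Level using (0ℓ)
open import Axiom.ExcludedMiddle using (ExcludedMiddle)
open import Defs
open import Data.List using (List)
open import Data.List.Relation.Unary.All using (All)
open import Data.List.Relation.Unary.Unique.Propositional using (Unique)
open import Data.Nat using (ℕ; zero; suc)
open import Data.Product using (∃; _×_; _,_)
open import Data.Empty using (⊥-elim)
open import Data.Sum using (inj₁; inj₂; swap)
open import Relation.Nullary using (¬_; Dec; yes; no)
open import Relation.Unary using (_⊆′_)
open import Relation.Binary.PropositionalEquality using (_≡_; refl; sym; trans; cong; subst)
open import Function.Base using (_∘_; case_of_)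
open import Function.Bundles using (_⇔_; mk⇔; Equivalence)

module _ {Γ : List Expr} where

  last : GS Γ → Atom Γ
  last (end G)      = G
  last (step _ _ w) = last w

  first-Fuse : ∀ {x y z : GS Γ} → Fuse x y z → first z ≡ first x
  first-Fuse (fuse-end p)  = p
  first-Fuse (fuse-step _) = refl

  last-Fuse : ∀ {x y z : GS Γ} → Fuse x y z → last x ≡ first y
  last-Fuse (fuse-end p)  = sym p
  last-Fuse (fuse-step f) = last-Fuse f

  Fuse-defined : ∀ x y → last x ≡ first y → ∃ (Fuse x y)
  Fuse-defined (end G)      y p = y , fuse-end (sym p)
  Fuse-defined (step G a x) y p with Fuse-defined x y p
  ... | z , f = step G a z , fuse-step f

  Fuse-identityʳ : ∀ x → Fuse x (end (last x)) x
  Fuse-identityʳ (end G)      = fuse-end refl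
  Fuse-identityʳ (step G a x) = fuse-step (Fuse-identityʳ x)

  Fuse-endʳ : ∀ {x z : GS Γ} {G} → Fuse x (end G) z → z ≡ x
  Fuse-endʳ (fuse-end p)  = cong end p
  Fuse-endʳ (fuse-step f) = cong (step _ _) (Fuse-endʳ f)

  Fuse-assocʳ : ∀ {x y z xy r : GS Γ} → Fuse x y xy → Fuse xy z r →
                ∃ λ yz → Fuse y z yz × Fuse x yz r
  Fuse-assocʳ (fuse-end p) g = _ , g , fuse-end (trans (first-Fuse g) p)
  Fuse-assocʳ (fuse-step f) (fuse-step g) with Fuse-assocʳ f g
  ... | yz , f′ , g′ = yz , f′ , fuse-step g′

  Fuse-assocˡ : ∀ {x y z yz r : GS Γ} → Fuse y z yz → Fuse x yz r →
                ∃ λ xy → Fuse x y xy × Fuse xy z r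
  Fuse-assocˡ f (fuse-end p) = _ , fuse-end (trans (sym (first-Fuse f)) p) , f
  Fuse-assocˡ f (fuse-step g) with Fuse-assocˡ f g
  ... | xy , f′ , g′ = step _ _ xy , fuse-step f′ , fuse-step g′

  first-InCS : ∀ {w : GS Γ} → InCS w → Consistent Γ (first w)
  first-InCS (cs-end c)    = c
  first-InCS (cs-step c _) = c

  last-InCS : ∀ {w : GS Γ} → InCS w → Consistent Γ (last w)
  last-InCS (cs-end c)    = c
  last-InCS (cs-step _ i) = last-InCS i

  Fuse-InCS : ∀ {x y z : GS Γ} → InCS x → InCS y → Fuse x y z → InCS z
  Fuse-InCS _              iy (fuse-end _)  = iy
  Fuse-InCS (cs-step c ix) iy (fuse-step f) = cs-step c (Fuse-InCS ix iy f)

module _ {Γ : List Expr} where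

  private
    variable
      A A′ B B′ C : Lang Γ
      G : Atom Γ
      w : GS Γ

  ⊆-antisym : A ⊆′ B → B ⊆′ A → A ≐ B
  ⊆-antisym A⊆B B⊆A w = mk⇔ (A⊆B w) (B⊆A w)

  ≐⇒⊆ : A ≐ B → A ⊆′ B
  ≐⇒⊆ A≐B w = Equivalence.to (A≐B w)

  ≐⇒⊇ : A ≐ B → B ⊆′ A
  ≐⇒⊇ A≐B w = Equivalence.from (A≐B w)

  ⊆-refl : A ⊆′ A
  ⊆-refl _ a = a

  ⊆-trans : A ⊆′ B → B ⊆′ C → A ⊆′ C
  ⊆-trans A⊆B B⊆C w a = B⊆C w (A⊆B w a)

  ≐-refl : A ≐ A
  ≐-refl = ⊆-antisym ⊆-refl ⊆-refl

  ≐-sym : A ≐ B → B ≐ A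
  ≐-sym A≐B = ⊆-antisym (≐⇒⊇ A≐B) (≐⇒⊆ A≐B)

  ≐-trans : A ≐ B → B ≐ C → A ≐ C
  ≐-trans A≐B B≐C = ⊆-antisym (⊆-trans (≐⇒⊆ A≐B) (≐⇒⊆ B≐C)) (⊆-trans (≐⇒⊇ B≐C) (≐⇒⊇ A≐B))

  ⊆⇒∪≐ : A ⊆′ B → (A ∪L B) ≐ B
  ⊆⇒∪≐ A⊆B = ⊆-antisym (λ { w (inj₁ a) → A⊆B w a ; _ (inj₂ b) → b }) (λ _ → inj₂)

  ∪≐⇒⊆ : (A ∪L B) ≐ B → A ⊆′ B
  ∪≐⇒⊆ A∪B≐B w a = ≐⇒⊆ A∪B≐B w (inj₁ a)

  ∪-mono : A ⊆′ A′ → B ⊆′ B′ → A ∪L B ⊆′ A′ ∪L B′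
  ∪-mono f g w (inj₁ a) = inj₁ (f w a)
  ∪-mono f g w (inj₂ b) = inj₂ (g w b)

  ∪-cong : A ≐ A′ → B ≐ B′ → (A ∪L B) ≐ (A′ ∪L B′)
  ∪-cong p q = ⊆-antisym (∪-mono (≐⇒⊆ p) (≐⇒⊆ q)) (∪-mono (≐⇒⊇ p) (≐⇒⊇ q))

  ∪-assoc : ((A ∪L B) ∪L C) ≐ (A ∪L (B ∪L C))
  ∪-assoc = ⊆-antisym
    (λ { _ (inj₁ (inj₁ a)) → inj₁ a ; _ (inj₁ (inj₂ b)) → inj₂ (inj₁ b) ; _ (inj₂ c) → inj₂ (inj₂ c) })
    (λ { _ (inj₁ a) → inj₁ (inj₁ a) ; _ (inj₂ (inj₁ b)) → inj₁ (inj₂ b) ; _ (inj₂ (inj₂ c)) → inj₂ c })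

  ∪-comm : (A ∪L B) ≐ (B ∪L A)
  ∪-comm = ⊆-antisym (λ _ → swap) (λ _ → swap)

  ∪-idem : (A ∪L A) ≐ A
  ∪-idem = ⊆⇒∪≐ ⊆-refl

  ∪-identityʳ : (A ∪L ∅L) ≐ A
  ∪-identityʳ = ⊆-antisym (λ { _ (inj₁ a) → a ; _ (inj₂ ()) }) (λ _ → inj₁)

  ◇-mono : A ⊆′ A′ → B ⊆′ B′ → A ◇ B ⊆′ A′ ◇ B′
  ◇-mono f g _ (x , y , ax , by , xy) = x , y , f x ax , g y by , xy

  ◇-cong : A ≐ A′ → B ≐ B′ → (A ◇ B) ≐ (A′ ◇ B′)
  ◇-cong p q = ⊆-antisym (◇-mono (≐⇒⊆ p) (≐⇒⊆ q)) (◇-mono (≐⇒⊇ p) (≐⇒⊇ q))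

  ◇-assoc : ((A ◇ B) ◇ C) ≐ (A ◇ (B ◇ C))
  ◇-assoc = ⊆-antisym
    (λ { _ (xy , z , (x , y , ax , by , f) , cz , g) →
           let yz , f′ , g′ = Fuse-assocʳ f g in x , yz , ax , (y , z , by , cz , f′) , g′ })
    (λ { _ (x , yz , ax , (y , z , by , cz , f) , g) →
           let xy , f′ , g′ = Fuse-assocˡ f g in xy , z , (x , y , ax , by , f′) , cz , g′ })

  ◇-identityˡ-⊆ : OneL ◇ A ⊆′ A
  ◇-identityˡ-⊆ _ (_ , _ , (_ , refl , _) , ay , fuse-end _) = ay

  ◇-identityʳ-⊆ : A ◇ OneL ⊆′ A
  ◇-identityʳ-⊆ {A = A} _ (_ , _ , ax , (_ , refl , _) , f) = subst A (sym (Fuse-endʳ f)) ax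

  ◇-identityˡ : A ⊆′ InCS → (OneL ◇ A) ≐ A
  ◇-identityˡ A⊆CS = ⊆-antisym ◇-identityˡ-⊆
    (λ w aw → end (first w) , w , (first w , refl , first-InCS (A⊆CS w aw)) , aw , fuse-end refl)

  ◇-identityʳ : A ⊆′ InCS → (A ◇ OneL) ≐ A
  ◇-identityʳ A⊆CS = ⊆-antisym ◇-identityʳ-⊆
    (λ w aw → w , end (last w) , aw , (last w , refl , last-InCS (A⊆CS w aw)) , Fuse-identityʳ w)

  ◇-zeroˡ : (∅L ◇ A) ≐ ∅L
  ◇-zeroˡ = ⊆-antisym (λ { _ (_ , _ , () , _) }) (λ _ ())

  ◇-zeroʳ : (A ◇ ∅L) ≐ ∅L
  ◇-zeroʳ = ⊆-antisym (λ { _ (_ , _ , _ , () , _) }) (λ _ ())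

  ◇-distribˡ-∪ : (A ◇ (B ∪L C)) ≐ ((A ◇ B) ∪L (A ◇ C))
  ◇-distribˡ-∪ = ⊆-antisym
    (λ { _ (x , y , ax , inj₁ by , f) → inj₁ (x , y , ax , by , f)
       ; _ (x , y , ax , inj₂ cy , f) → inj₂ (x , y , ax , cy , f) })
    (λ { _ (inj₁ (x , y , ax , by , f)) → x , y , ax , inj₁ by , f
       ; _ (inj₂ (x , y , ax , cy , f)) → x , y , ax , inj₂ cy , f })

  ◇-distribʳ-∪ : ((B ∪L C) ◇ A) ≐ ((B ◇ A) ∪L (C ◇ A))
  ◇-distribʳ-∪ = ⊆-antisym
    (λ { _ (x , y , inj₁ bx , ay , f) → inj₁ (x , y , bx , ay , f)
       ; _ (x , y , inj₂ cx , ay , f) → inj₂ (x , y , cx , ay , f) })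
    (λ { _ (inj₁ (x , y , bx , ay , f)) → x , y , inj₁ bx , ay , f
       ; _ (inj₂ (x , y , cx , ay , f)) → x , y , inj₂ cx , ay , f })

  One⊆InCS : OneL ⊆′ InCS {Γ}
  One⊆InCS _ (_ , refl , c) = cs-end c

  ◇-InCS : A ⊆′ InCS → B ⊆′ InCS → A ◇ B ⊆′ InCS
  ◇-InCS A⊆CS B⊆CS _ (x , y , ax , by , f) = Fuse-InCS (A⊆CS x ax) (B⊆CS y by) f

  pow-InCS : A ⊆′ InCS → ∀ n → powL A n ⊆′ InCS
  pow-InCS A⊆CS zero    = One⊆InCS
  pow-InCS A⊆CS (suc n) = ◇-InCS (pow-InCS A⊆CS n) A⊆CS

  pow-mono : A ⊆′ B → ∀ n → powL A n ⊆′ powL B n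
  pow-mono A⊆B zero    = ⊆-refl
  pow-mono A⊆B (suc n) = ◇-mono (pow-mono A⊆B n) A⊆B

  pow-sucˡ : A ⊆′ InCS → ∀ n → powL A (suc n) ≐ (A ◇ powL A n)
  pow-sucˡ A⊆CS zero    = ≐-trans (◇-identityˡ A⊆CS) (≐-sym (◇-identityʳ A⊆CS))
  pow-sucˡ A⊆CS (suc n) = ≐-trans (◇-cong (pow-sucˡ A⊆CS n) ≐-refl) ◇-assoc

  star-cong : A ≐ B → starL A ≐ starL B
  star-cong A≐B = ⊆-antisym (λ { _ (n , a) → n , pow-mono (≐⇒⊆ A≐B) n _ a })
                            (λ { _ (n , b) → n , pow-mono (≐⇒⊇ A≐B) n _ b })

  star-unfoldˡ : A ⊆′ InCS → OneL ∪L (A ◇ starL A) ⊆′ starL A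
  star-unfoldˡ A⊆CS _ (inj₁ one) = zero , one
  star-unfoldˡ A⊆CS w (inj₂ (x , y , ax , (n , an) , f)) =
    suc n , ≐⇒⊇ (pow-sucˡ A⊆CS n) w (x , y , ax , an , f)

  star-unfoldʳ : OneL ∪L (starL A ◇ A) ⊆′ starL A
  star-unfoldʳ _ (inj₁ one) = zero , one
  star-unfoldʳ _ (inj₂ (x , y , (n , an) , ay , f)) = suc n , (x , y , an , ay , f)

  star-inductionˡ : A ⊆′ InCS → B ∪L (A ◇ C) ⊆′ C → starL A ◇ B ⊆′ C
  star-inductionˡ {A = A} {B = B} {C = C} A⊆CS B∪AC⊆C w (x , y , (n , an) , by , f) =
    pow◇B⊆C n w (x , y , an , by , f)
    where
    pow◇B⊆C : ∀ n → powL A n ◇ B ⊆′ C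
    pow◇B⊆C zero    = ⊆-trans ◇-identityˡ-⊆ (λ w → B∪AC⊆C w ∘ inj₁)
    pow◇B⊆C (suc n) = ⊆-trans (◇-mono (≐⇒⊆ (pow-sucˡ A⊆CS n)) ⊆-refl)
                     (⊆-trans (≐⇒⊆ ◇-assoc)
                     (⊆-trans (◇-mono ⊆-refl (pow◇B⊆C n)) (λ w → B∪AC⊆C w ∘ inj₂)))

  star-inductionʳ : B ∪L (C ◇ A) ⊆′ C → B ◇ starL A ⊆′ C
  star-inductionʳ {B = B} {C = C} {A = A} B∪CA⊆C w (x , y , bx , (n , an) , f) =
    B◇pow⊆C n w (x , y , bx , an , f)
    where
    B◇pow⊆C : ∀ n → B ◇ powL A n ⊆′ C
    B◇pow⊆C zero    = ⊆-trans ◇-identityʳ-⊆ (λ w → B∪CA⊆C w ∘ inj₁)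
    B◇pow⊆C (suc n) = ⊆-trans (≐⇒⊇ ◇-assoc)
                     (⊆-trans (◇-mono (B◇pow⊆C n) ⊆-refl) (λ w → B∪CA⊆C w ∘ inj₂))

  Starts : Lang Γ → Atom Γ → Set
  Starts A G = ¬ Empty (singleton G ◇ A)

  singleton-◇⁺ : A w → first w ≡ G → (singleton G ◇ A) w
  singleton-◇⁺ aw p = end _ , _ , refl , aw , fuse-end p

  singleton-◇⁻ : (singleton G ◇ A) w → A w × first w ≡ G
  singleton-◇⁻ (_ , _ , refl , aw , fuse-end p) = aw , p

  Starts-first : A w → Starts A (first w)
  Starts-first aw empty = empty _ (singleton-◇⁺ aw refl)

  Starts-⊆ : (∀ w → A w → Starts B (first w)) → Starts A ⊆′ Starts B
  Starts-⊆ {B = B} starts G A-starts B-empty = A-starts λ w el →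
    let aw , p = singleton-◇⁻ el in subst (Starts B) p (starts w aw) B-empty

  ⊆⇒Starts⊆ : A ⊆′ B → Starts A ⊆′ Starts B
  ⊆⇒Starts⊆ A⊆B = Starts-⊆ λ w aw → Starts-first (A⊆B w aw)

  antidom-antitone : Starts A ⊆′ Starts B → antidomL B ⊆′ antidomL A
  antidom-antitone starts⊆ _ (G , p , c , B-empty) =
    G , p , c , λ w el → starts⊆ G (λ empty → empty w el) B-empty

  dom-monotone : Starts A ⊆′ Starts B → domL A ⊆′ domL B
  dom-monotone starts⊆ _ (G , p , c , A-starts) = G , p , c , starts⊆ G A-starts

  antidom-cong : A ≐ B → antidomL A ≐ antidomL B
  antidom-cong A≐B = ⊆-antisym (antidom-antitone (⊆⇒Starts⊆ (≐⇒⊇ A≐B)))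
                               (antidom-antitone (⊆⇒Starts⊆ (≐⇒⊆ A≐B)))

  dom-cong : A ≐ B → domL A ≐ domL B
  dom-cong A≐B = ⊆-antisym (dom-monotone (⊆⇒Starts⊆ (≐⇒⊆ A≐B)))
                           (dom-monotone (⊆⇒Starts⊆ (≐⇒⊇ A≐B)))

  antidom⊆One : antidomL A ⊆′ OneL
  antidom⊆One _ (G , p , c , _) = G , p , c

  dom⊆One : domL A ⊆′ OneL
  dom⊆One _ (G , p , c , _) = G , p , c

  Starts-◇-dom : B ⊆′ InCS → Starts (A ◇ B) ⊆′ Starts (A ◇ domL B)
  Starts-◇-dom {B = B} B⊆CS = Starts-⊆ λ { _ (x , y , ax , by , f) →
    subst (Starts _) (sym (first-Fuse f))
          (Starts-first (x , end (first y) , ax , first-dom y by , fuse-last f)) }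
    where
    first-dom : ∀ y → B y → domL B (end (first y))
    first-dom y by = first y , refl , first-InCS (B⊆CS y by) , Starts-first by
    fuse-last : ∀ {x y z} → Fuse x y z → Fuse x (end (first y)) x
    fuse-last {x} f = subst (λ H → Fuse x (end H) x) (last-Fuse f) (Fuse-identityʳ x)

  Starts-◇-dom⁻ : Starts (A ◇ domL B) ⊆′ Starts (A ◇ B)
  Starts-◇-dom⁻ = Starts-⊆ λ { _ (x , _ , ax , (H , refl , _ , B-starts) , f) →
    λ AB-empty → B-starts λ y el →
      let by , q = singleton-◇⁻ el
          z , g  = Fuse-defined x y (trans (last-Fuse f) (sym q))
      in AB-empty z (singleton-◇⁺ (x , y , ax , by , g) (trans (first-Fuse g) (sym (first-Fuse f)))) }

  antidom-local : B ⊆′ InCS → antidomL (A ◇ B) ≐ antidomL (A ◇ domL B)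
  antidom-local B⊆CS = ⊆-antisym (antidom-antitone Starts-◇-dom⁻)
                                 (antidom-antitone (Starts-◇-dom B⊆CS))

  antidom-annihilatorˡ : (antidomL A ◇ A) ≐ ∅L
  antidom-annihilatorˡ = ⊆-antisym
    (λ { _ (_ , y , (_ , refl , _ , empty) , ay , fuse-end p) → empty y (singleton-◇⁺ ay p) })
    (λ _ ())

  antidom-∪-dom : ExcludedMiddle 0ℓ → (antidomL A ∪L domL A) ≐ OneL
  antidom-∪-dom {A = A} em = ⊆-antisym
    (λ { w (inj₁ a) → antidom⊆One w a ; w (inj₂ d) → dom⊆One w d })
    (λ { _ (G , p , c) → case-empty G p c em })
    where
    case-empty : ∀ G → w ≡ end G → Consistent Γ G → Dec (Empty (singleton G ◇ A)) →
                 (antidomL A ∪L domL A) w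
    case-empty G p c (yes empty) = inj₁ (G , p , c , empty)
    case-empty G p c (no starts) = inj₂ (G , p , c , starts)

  Empty-singleton-antidom : Consistent Γ G → Empty (singleton G ◇ antidomL A) ⇔ Starts A G
  Empty-singleton-antidom {G = G} c = mk⇔
    (λ empty A-empty → empty (end G) (singleton-◇⁺ (G , refl , c , A-empty) refl))
    (λ { A-starts _ el → case singleton-◇⁻ el of λ
           { ((_ , refl , _ , A-empty) , refl) → A-starts A-empty } })

  dom≐antidom-antidom : domL A ≐ antidomL (antidomL A)
  dom≐antidom-antidom = ⊆-antisym
    (λ { _ (G , p , c , starts) → G , p , c , Equivalence.from (Empty-singleton-antidom c) starts })
    (λ { _ (G , p , c , empty) → G , p , c , Equivalence.to (Empty-singleton-antidom c) empty })

  ⊆One⇒dom≐ : ExcludedMiddle 0ℓ → A ⊆′ OneL → domL A ≐ A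
  ⊆One⇒dom≐ {A = A} em A⊆One = ⊆-antisym
    (λ { _ (G , refl , _ , starts) → decide G starts em })
    (λ { w aw → case A⊆One w aw of λ { (G , refl , c) → G , refl , c , Starts-first aw } })
    where
    decide : ∀ G → Starts A G → Dec (A (end G)) → A (end G)
    decide G starts (yes a) = a
    decide G starts (no ¬a) = ⊥-elim (starts λ w el → case singleton-◇⁻ el of λ
      { (aw , refl) → case A⊆One w aw of λ { (_ , refl , _) → ¬a aw } })

module _ {Γ : List Expr} where

  ⟦⟧⊆InCS : ∀ e → ⟦ e ⟧ Γ ⊆′ InCS
  ⟦⟧⊆InCS (act a)  _ (_ , _ , _ , w∈CS , _) = w∈CS
  ⟦⟧⊆InCS (prop p) _ (_ , refl , c , _)     = cs-end c
  ⟦⟧⊆InCS 𝟘        _ ()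
  ⟦⟧⊆InCS 𝟙        = One⊆InCS
  ⟦⟧⊆InCS (e ⊕ f)  w (inj₁ x) = ⟦⟧⊆InCS e w x
  ⟦⟧⊆InCS (e ⊕ f)  w (inj₂ x) = ⟦⟧⊆InCS f w x
  ⟦⟧⊆InCS (e ⊙ f)  = ◇-InCS (⟦⟧⊆InCS e) (⟦⟧⊆InCS f)
  ⟦⟧⊆InCS (e ᴬ)    = ⊆-trans antidom⊆One One⊆InCS
  ⟦⟧⊆InCS (e ᴰ)    = ⊆-trans dom⊆One One⊆InCS
  ⟦⟧⊆InCS (e ⋆)    w (n , x) = pow-InCS (⟦⟧⊆InCS e) n w x

  ⟦prop⟧⊆One : ∀ p → ⟦ prop p ⟧ Γ ⊆′ OneL
  ⟦prop⟧⊆One p _ (G , w≡G , c , _) = G , w≡G , c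

  ⟦⟧-sound : ExcludedMiddle 0ℓ → ∀ {e f} → e ≅ f → (⟦ e ⟧ Γ) ≐ (⟦ f ⟧ Γ)
  ⟦⟧-sound em ≅-refl            = ≐-refl
  ⟦⟧-sound em (≅-sym p)         = ≐-sym (⟦⟧-sound em p)
  ⟦⟧-sound em (≅-trans p q)     = ≐-trans (⟦⟧-sound em p) (⟦⟧-sound em q)
  ⟦⟧-sound em (⊕-cong p q)      = ∪-cong (⟦⟧-sound em p) (⟦⟧-sound em q)
  ⟦⟧-sound em (⊙-cong p q)      = ◇-cong (⟦⟧-sound em p) (⟦⟧-sound em q)
  ⟦⟧-sound em (ᴬ-cong p)        = antidom-cong (⟦⟧-sound em p)
  ⟦⟧-sound em (ᴰ-cong p)        = dom-cong (⟦⟧-sound em p)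
  ⟦⟧-sound em (⋆-cong p)        = star-cong (⟦⟧-sound em p)
  ⟦⟧-sound em (⊕-assoc _ _ _)   = ∪-assoc
  ⟦⟧-sound em (⊕-comm _ _)      = ∪-comm
  ⟦⟧-sound em (⊕-idem _)        = ∪-idem
  ⟦⟧-sound em (⊕-zero _)        = ∪-identityʳ
  ⟦⟧-sound em (⊙-assoc _ _ _)   = ◇-assoc
  ⟦⟧-sound em (⊙-idˡ e)         = ◇-identityˡ (⟦⟧⊆InCS e)
  ⟦⟧-sound em (⊙-idʳ e)         = ◇-identityʳ (⟦⟧⊆InCS e)
  ⟦⟧-sound em (⊙-zeroˡ _)       = ◇-zeroˡ
  ⟦⟧-sound em (⊙-zeroʳ _)       = ◇-zeroʳ
  ⟦⟧-sound em (distribˡ _ _ _)  = ◇-distribˡ-∪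
  ⟦⟧-sound em (distribʳ _ _ _)  = ◇-distribʳ-∪
  ⟦⟧-sound em (⋆-unfoldˡ e)     = ⊆⇒∪≐ (star-unfoldˡ (⟦⟧⊆InCS e))
  ⟦⟧-sound em (⋆-unfoldʳ _)     = ⊆⇒∪≐ star-unfoldʳ
  ⟦⟧-sound em (⋆-indˡ {e} p)    = ⊆⇒∪≐ (star-inductionˡ (⟦⟧⊆InCS e) (∪≐⇒⊆ (⟦⟧-sound em p)))
  ⟦⟧-sound em (⋆-indʳ p)        = ⊆⇒∪≐ (star-inductionʳ (∪≐⇒⊆ (⟦⟧-sound em p)))
  ⟦⟧-sound em (ᴬ-annih _)       = antidom-annihilatorˡ
  ⟦⟧-sound em (ᴬ-local _ f)     = antidom-local (⟦⟧⊆InCS f)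
  ⟦⟧-sound em (ᴬᴰ-compl _)      = antidom-∪-dom em
  ⟦⟧-sound em (prop-ᴰ p)        = ⊆One⇒dom≐ em (⟦prop⟧⊆One p)
  ⟦⟧-sound em (ᴰ-def _)         = dom≐antidom-antidom

lemma2 : ExcludedMiddle 0ℓ → (Γ : List Expr) → All IsParam Γ → Unique Γ →
    ∀ e f → e ≅ f → (⟦ e ⟧ Γ) ≐ (⟦ f ⟧ Γ)
lemma2 em Γ _ _ _ _ = ⟦⟧-sound em
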